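{- Let $N,n\ge 0$ be integers. Let $S_N(n)$ be the number of partitions $\pi=(\lambda_1,\lambda_2,\dots)$ into distinct parts with $\mathcal{O}(\pi)=n$ and $\lambda_1\le N$. Let $\Gamma_N(n)$ be the number of partitions of $n$ whose largest hook length is $\le N$. Then $S_N(n)=\Gamma_N(n)$.
   Context: A partition is a finite non-increasing sequence of positive integers; the empty sequence is the unique partition of $0$. $\mathcal{O}(\pi)=\lambda_1+\lambda_3+\lambda_5+\cdots$. The hook length of a box in the Ferrers diagram is one plus the number of boxes directly to its right plus the number directly below it; the largest hook length of a nonempty partition equals (number of parts) + (largest part) $-1$, and is $0$ for the empty partition. -}

module Defs where

open import Data.Nat using (ℕ; zero; suc; _+_; _∸_; _≤_; _<_; _≥_)
open import Data.List using (List; []; _∷_; length)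
open import Data.Nat.ListAction using (sum)
open import Relation.Binary.PropositionalEquality using (_≡_)
open import Data.List.Membership.Propositional using (_∈_)
open import Data.List.Relation.Unary.Unique.Propositional using (Unique)
open import Data.List.Relation.Unary.Linked using (Linked)
open import Data.List.Relation.Unary.All using (All)
open import Data.Product using (Σ; _×_)
open import Function.Bundles using (_⇔_)

IsPartition : List ℕ → Set
IsPartition xs = Linked _≥_ xs × All (λ x → 1 ≤ x) xs

IsDistinctPartition : List ℕ → Set
IsDistinctPartition xs = Linked (λ a b → b < a) xs × All (λ x → 1 ≤ x) xs

oddSum : List ℕ → ℕ
oddSum []           = 0
oddSum (x ∷ [])     = x
oddSum (x ∷ y ∷ xs) = x + oddSum xs

largestPart : List ℕ → ℕ
largestPart []      = 0
largestPart (x ∷ _) = x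

largestHook : List ℕ → ℕ
largestHook []         = 0
largestHook (x ∷ xs) = length (x ∷ xs) + x ∸ 1

HasCount : (List ℕ → Set) → ℕ → Set
HasCount P k = Σ (List (List ℕ)) λ L →
  Unique L × ((π : List ℕ) → (π ∈ L ⇔ P π)) × length L ≡ k

SPred : ℕ → ℕ → List ℕ → Set
SPred N n π = IsDistinctPartition π × oddSum π ≡ n × largestPart π ≤ N

ΓPred : ℕ → ℕ → List ℕ → Set
ΓPred N n π = IsPartition π × sum π ≡ n × largestHook π ≤ N

-- Read off the hook lengths h₁₁ > h₁₂ > h₂₂ > h₂₃ > h₃₃ > ⋯ of the cells (i,i) and (i,i+1)
-- on and just above the diagonal of a partition μ. They form a partition into distinct parts
-- whose largest part h₁₁ is the largest hook of μ, and whose odd-indexed parts are the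
-- principal hooks h₁₁, h₂₂, …, which sum to |μ|. Conversely every such sequence arises from
-- exactly one μ: peeling off the first row and column of μ turns (h₁₁, h₁₂, h₂₂, …) into
-- (h₂₂, h₂₃, …), and h₁₁, h₁₂ together with the inner partition determine the peeled hook.
module Submission where

open import Defs
open import Data.Nat using (ℕ; zero; suc; pred; _+_; _∸_; _≤_; _<_; _≥_; _>_; z≤n; s≤s; _≟_)
open import Data.Nat.Properties
open import Data.Nat.ListAction using (sum)
open import Data.Nat.Tactic.RingSolver using (solve-∀)
open import Data.List using (List; []; _∷_; length; map; _++_; replicate; filter)
open import Data.List.Properties using (length-replicate; length-map; ∷-injective; ∷-injectiveʳ)
open import Data.List.Relation.Unary.Linked as Linked using (Linked; []; [-]; _∷_)
open import Data.List.Relation.Unary.All as All using (All; []; _∷_)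
import Data.List.Relation.Unary.All.Properties as All
open import Data.List.Relation.Unary.Any using (here; there)
open import Data.List.Membership.Propositional using (_∈_)
open import Data.List.Membership.Propositional.Properties
  using (∈-map⁺; ∈-map⁻; ∈-++⁺ˡ; ∈-++⁺ʳ; ∈-++⁻; ∈-filter⁺; ∈-filter⁻)
open import Data.List.Relation.Unary.Unique.Propositional using (Unique; []; _∷_)
import Data.List.Relation.Unary.Unique.Propositional.Properties as Unique
open import Data.Product using (Σ; _×_; _,_; proj₁; proj₂; map₁; map₂)
open import Data.Sum using (inj₁; inj₂)
open import Data.Empty using (⊥-elim)
open import Function using (_∘′_)
open import Function.Bundles using (_⇔_; mk⇔; Equivalence)
open import Relation.Nullary using (¬_)
open import Relation.Unary using (Decidable)
open import Relation.Binary.PropositionalEquality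
  using (_≡_; refl; sym; trans; cong; cong₂; subst; module ≡-Reasoning)

unique-map⁺ : ∀ {A B : Set} {f : A → B} {xs} → (∀ {x y} → x ∈ xs → y ∈ xs → f x ≡ f y → x ≡ y) →
              Unique xs → Unique (map f xs)
unique-map⁺ {xs = []}    _   _          = []
unique-map⁺ {xs = _ ∷ _} inj (x∉ ∷ uniq) =
  All.map⁺ (All.tabulate (λ y∈ fx≡fy → All.lookup x∉ y∈ (inj (here refl) (there y∈) fx≡fy)))
  ∷ unique-map⁺ (λ x∈ y∈ → inj (there x∈) (there y∈)) uniq

hasCount-⇔ : ∀ {P Q : List ℕ → Set} {k} → (∀ π → P π ⇔ Q π) → HasCount P k → HasCount Q k
hasCount-⇔ P⇔Q (L , uniq , ∈L⇔P , len) =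
  L , uniq , (λ π → mk⇔ (Equivalence.to (P⇔Q π) ∘′ Equivalence.to (∈L⇔P π))
                        (Equivalence.from (∈L⇔P π) ∘′ Equivalence.from (P⇔Q π))) , len

hasCount-filter : ∀ {P Q : List ℕ → Set} {L} → Unique L → (∀ π → π ∈ L ⇔ P π) → (Q? : Decidable Q) →
                  HasCount (λ π → P π × Q π) (length (filter Q? L))
hasCount-filter {L = L} uniq ∈L⇔P Q? =
  filter Q? L , Unique.filter⁺ Q? uniq ,
  (λ π → mk⇔ (λ π∈ → let π∈L , qπ = ∈-filter⁻ Q? π∈ in Equivalence.to (∈L⇔P π) π∈L , qπ)
             (λ (pπ , qπ) → ∈-filter⁺ Q? (Equivalence.from (∈L⇔P π) pπ) qπ)) ,
  refl

hasCount-image : ∀ {P Q : List ℕ → Set} {k} (f : List ℕ → List ℕ) →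
  (∀ {π} → P π → Q (f π)) →
  (∀ {π σ} → P π → P σ → f π ≡ f σ → π ≡ σ) →
  (∀ {μ} → Q μ → Σ (List ℕ) λ π → P π × f π ≡ μ) →
  HasCount P k → HasCount Q k
hasCount-image {P} {Q} f P⇒Qf f-injective Q⇒image (L , uniq , ∈L⇔P , refl) =
  map f L , unique-map⁺ (λ x∈ y∈ → f-injective (∈L⇒P x∈) (∈L⇒P y∈)) uniq , ∈fL⇔Q , length-map f L
  where
    ∈L⇒P : ∀ {π} → π ∈ L → P π
    ∈L⇒P {π} = Equivalence.to (∈L⇔P π)
    ∈fL⇔Q : ∀ μ → μ ∈ map f L ⇔ Q μ
    ∈fL⇔Q μ = mk⇔ (λ μ∈ → let π , π∈ , μ≡fπ = ∈-map⁻ f μ∈ in subst Q (sym μ≡fπ) (P⇒Qf (∈L⇒P π∈)))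
                  (λ qμ → let π , pπ , fπ≡μ = Q⇒image qμ
                          in subst (_∈ map f L) fπ≡μ (∈-map⁺ f (Equivalence.from (∈L⇔P π) pπ)))

AllPositive : List ℕ → Set
AllPositive = All (λ x → 1 ≤ x)

largestPart≤0⇒≡[] : ∀ {μ} → AllPositive μ → largestPart μ ≤ 0 → μ ≡ []
largestPart≤0⇒≡[] []          _  = refl
largestPart≤0⇒≡[] (s≤s _ ∷ _) ()

largestPart-tail-≤ : ∀ {b μ} → Linked _≥_ (b ∷ μ) → largestPart μ ≤ b
largestPart-tail-≤ [-]       = z≤n
largestPart-tail-≤ (b≥c ∷ _) = b≥c

largestPart-tail-< : ∀ {b hs} → IsDistinctPartition (b ∷ hs) → largestPart hs < b
largestPart-tail-< ([-] , b>0 ∷ [])  = b>0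
largestPart-tail-< (b>c ∷ _ , _)     = b>c

linked-≥-∷ : ∀ {b μ} → Linked _≥_ μ → largestPart μ ≤ b → Linked _≥_ (b ∷ μ)
linked-≥-∷ {μ = []}    _  _   = [-]
linked-≥-∷ {μ = _ ∷ _} lk b≥c = b≥c ∷ lk

linked->-∷ : ∀ {b hs} → Linked _>_ hs → largestPart hs < b → Linked _>_ (b ∷ hs)
linked->-∷ {hs = []}    _  _   = [-]
linked->-∷ {hs = _ ∷ _} lk b>c = b>c ∷ lk

largestHook≡length+largestPart∸1 : ∀ μ → largestHook μ ≡ length μ + largestPart μ ∸ 1
largestHook≡length+largestPart∸1 []      = refl
largestHook≡length+largestPart∸1 (_ ∷ _) = refl

distinctPartition-tail : ∀ {x hs} → IsDistinctPartition (x ∷ hs) → IsDistinctPartition hs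
distinctPartition-tail (lk , _ ∷ pos) = Linked.tail lk , pos

-- withColumn μ r is μ moved one column to the right, next to a new first column of height length μ + r.
withColumn : List ℕ → ℕ → List ℕ
withColumn μ r = map suc μ ++ replicate r 1

-- hook a r μ wraps a hook with arm a and leg length μ + r around μ.
hook : ℕ → ℕ → List ℕ → List ℕ
hook a r μ = suc a ∷ withColumn μ r

length-withColumn : ∀ μ r → length (withColumn μ r) ≡ length μ + r
length-withColumn []      r = length-replicate r
length-withColumn (_ ∷ μ) r = cong suc (length-withColumn μ r)

sum-replicate-1 : ∀ r → sum (replicate r 1) ≡ r
sum-replicate-1 zero    = refl
sum-replicate-1 (suc r) = cong suc (sum-replicate-1 r)

sum-withColumn : ∀ μ r → sum (withColumn μ r) ≡ sum μ + length μ + r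
sum-withColumn []      r = sum-replicate-1 r
sum-withColumn (x ∷ μ) r = begin
  suc x + sum (withColumn μ r)       ≡⟨ cong (suc x +_) (sum-withColumn μ r) ⟩
  suc x + (sum μ + length μ + r)     ≡⟨ rearrange x (sum μ) (length μ) r ⟩
  x + sum μ + suc (length μ) + r     ∎
  where
    open ≡-Reasoning
    rearrange : ∀ a b c d → suc a + (b + c + d) ≡ a + b + suc c + d
    rearrange = solve-∀

allPositive-withColumn : ∀ μ r → AllPositive (withColumn μ r)
allPositive-withColumn []      zero    = []
allPositive-withColumn []      (suc r) = s≤s z≤n ∷ allPositive-withColumn [] r
allPositive-withColumn (_ ∷ μ) r       = s≤s z≤n ∷ allPositive-withColumn μ r

linked-withColumn : ∀ {a μ} r → Linked _≥_ μ → largestPart μ ≤ a → Linked _≥_ (suc a ∷ withColumn μ r)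
linked-withColumn {μ = []}    zero    _  _   = [-]
linked-withColumn {μ = []}    (suc r) _  _   = s≤s z≤n ∷ linked-withColumn r [] z≤n
linked-withColumn {μ = _ ∷ _} r       lk a≥b =
  s≤s a≥b ∷ linked-withColumn r (Linked.tail lk) (largestPart-tail-≤ lk)

isPartition-hook : ∀ {a μ} r → IsPartition μ → largestPart μ ≤ a → IsPartition (hook a r μ)
isPartition-hook {μ = μ} r (lk , _) a≥b =
  linked-withColumn r lk a≥b , s≤s z≤n ∷ allPositive-withColumn μ r

withColumn-injective : ∀ {μ ν} r s → AllPositive μ → AllPositive ν →
                       withColumn μ r ≡ withColumn ν s → μ ≡ ν × r ≡ s
withColumn-injective {[]}    {[]}    r       s       _ _ eq = refl , replicate-1-injective
  where
    replicate-1-injective : r ≡ s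
    replicate-1-injective = trans (sym (length-replicate r)) (trans (cong length eq) (length-replicate s))
withColumn-injective {[]}    {_ ∷ _} zero    _       _             _             ()
withColumn-injective {[]}    {_ ∷ _} (suc _) _       _             (s≤s z≤n ∷ _) ()
withColumn-injective {_ ∷ _} {[]}    _       zero    _             _             ()
withColumn-injective {_ ∷ _} {[]}    _       (suc _) (s≤s z≤n ∷ _) _             ()
withColumn-injective {_ ∷ _} {_ ∷ _} r s (_ ∷ pμ) (_ ∷ pν) eq
  with refl , eq′ ← ∷-injective eq = map₁ (cong (_ ∷_)) (withColumn-injective r s pμ pν eq′)

splitFirstColumn : ∀ {m t} → Linked _≥_ (m ∷ t) → AllPositive t →
  Σ (List ℕ) λ μ → Σ ℕ λ r →
    t ≡ withColumn μ r × IsPartition μ × largestPart μ ≤ pred m × length μ ≤ length t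
splitFirstColumn {t = []} _ _ = [] , 0 , refl , ([] , []) , z≤n , z≤n
splitFirstColumn {t = suc zero ∷ _} (_ ∷ lk) (_ ∷ pos)
  with splitFirstColumn lk pos
... | μ , r , refl , (_ , pμ) , μ≤0 , _
  with refl ← largestPart≤0⇒≡[] pμ μ≤0 = [] , suc r , refl , ([] , []) , z≤n , z≤n
splitFirstColumn {suc _} {suc (suc c) ∷ _} (s≤s c<m ∷ lk) (_ ∷ pos)
  with splitFirstColumn lk pos
... | μ , r , refl , (lkμ , pμ) , μ≤c , len =
  suc c ∷ μ , r , refl , (linked-≥-∷ lkμ μ≤c , s≤s z≤n ∷ pμ) , c<m , s≤s len

-- For hook lengths h₁₁ = x, h₁₂ = y with inner partition μ, the outer hook has arm y − length μ
-- and leg x − y − 1 + length μ.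
fromHooks : List ℕ → List ℕ
fromHooks []           = []
fromHooks (x ∷ [])     = hook 0 (x ∸ 1) []
fromHooks (x ∷ y ∷ hs) = hook (y ∸ length (fromHooks hs)) (x ∸ suc y) (fromHooks hs)

largestPart-fromHooks-positive : ∀ x hs → 0 < largestPart (fromHooks (x ∷ hs))
largestPart-fromHooks-positive _ []      = s≤s z≤n
largestPart-fromHooks-positive _ (_ ∷ _) = s≤s z≤n

mutual
  length+largestPart-fromHooks : ∀ {x hs} → IsDistinctPartition (x ∷ hs) →
    length (fromHooks (x ∷ hs)) + largestPart (fromHooks (x ∷ hs)) ≡ suc x
  length+largestPart-fromHooks {zero}  {[]} (_ , () ∷ [])
  length+largestPart-fromHooks {suc x} {[]} _ = begin
    suc (length (replicate x 1)) + 1 ≡⟨ cong (λ l → suc l + 1) (length-replicate x) ⟩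
    suc x + 1                        ≡⟨ +-comm (suc x) 1 ⟩
    suc (suc x)                      ∎
    where open ≡-Reasoning
  length+largestPart-fromHooks {x} {y ∷ hs} d@(y<x ∷ _ , _) = begin
    suc (length (withColumn μ r)) + suc arm ≡⟨ cong (λ l → suc l + suc arm) (length-withColumn μ r) ⟩
    suc (L + r) + suc arm                   ≡⟨ rearrange L r arm ⟩
    suc (suc (L + arm) + r)                 ≡⟨ cong (λ z → suc (suc z + r)) (m+[n∸m]≡n L≤y) ⟩
    suc (suc y + r)                         ≡⟨ cong suc (m+[n∸m]≡n y<x) ⟩
    suc x                                   ∎
    where
      open ≡-Reasoning
      μ = fromHooks hs
      L = length μ
      arm = y ∸ L
      r = x ∸ suc y
      L≤y : L ≤ y
      L≤y = <⇒≤ (length-fromHooks-< (distinctPartition-tail d))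
      rearrange : ∀ a b c → suc (a + b) + suc c ≡ suc (suc (a + c) + b)
      rearrange = solve-∀

  length-fromHooks-< : ∀ {y hs} → IsDistinctPartition (y ∷ hs) → length (fromHooks hs) < y
  length-fromHooks-< {hs = []}    (_ , y>0 ∷ _) = y>0
  length-fromHooks-< {hs = z ∷ r} d@(z<y ∷ _ , _) = <-≤-trans L<1+z z<y
    where
      L = length (fromHooks (z ∷ r))
      L<1+z : L < suc z
      L<1+z = subst (L <_) (length+largestPart-fromHooks (distinctPartition-tail d))
                    (m<m+n L (largestPart-fromHooks-positive z r))

largestHook-fromHooks : ∀ {hs} → IsDistinctPartition hs → largestHook (fromHooks hs) ≡ largestPart hs
largestHook-fromHooks {[]}        _ = refl
largestHook-fromHooks {_ ∷ []}    d = cong (_∸ 1) (length+largestPart-fromHooks d)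
largestHook-fromHooks {_ ∷ _ ∷ _} d = cong (_∸ 1) (length+largestPart-fromHooks d)

sum-fromHooks : ∀ {hs} → IsDistinctPartition hs → sum (fromHooks hs) ≡ oddSum hs
sum-fromHooks {[]}        _ = refl
sum-fromHooks {zero ∷ []}  (_ , () ∷ [])
sum-fromHooks {suc x ∷ []} _ = cong suc (sum-replicate-1 x)
sum-fromHooks {x ∷ y ∷ hs} d@(y<x ∷ _ , _) = begin
  suc arm + sum (withColumn μ r)  ≡⟨ cong (suc arm +_) (sum-withColumn μ r) ⟩
  suc arm + (sum μ + L + r)       ≡⟨ cong (λ s → suc arm + (s + L + r)) (sum-fromHooks d′′) ⟩
  suc arm + (S + L + r)           ≡⟨ rearrange L S r arm ⟩
  suc (L + arm) + r + S           ≡⟨ cong (λ z → suc z + r + S) (m+[n∸m]≡n L≤y) ⟩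
  suc y + r + S                   ≡⟨ cong (_+ S) (m+[n∸m]≡n y<x) ⟩
  x + S                           ∎
  where
    open ≡-Reasoning
    μ = fromHooks hs
    L = length μ
    arm = y ∸ L
    r = x ∸ suc y
    S = oddSum hs
    d′′ = distinctPartition-tail (distinctPartition-tail d)
    L≤y : L ≤ y
    L≤y = <⇒≤ (length-fromHooks-< (distinctPartition-tail d))
    rearrange : ∀ a b c e → suc e + (b + a + c) ≡ suc (a + e) + c + b
    rearrange = solve-∀

largestPart-fromHooks-≤ : ∀ {y hs} → IsDistinctPartition (y ∷ hs) →
  largestPart (fromHooks hs) ≤ y ∸ length (fromHooks hs)
largestPart-fromHooks-≤ {hs = []}    _ = z≤n
largestPart-fromHooks-≤ {y} {z ∷ r} d@(z<y ∷ _ , _) = m+n≤o⇒m≤o∸n _ (begin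
  largestPart μ + length μ ≡⟨ +-comm (largestPart μ) _ ⟩
  length μ + largestPart μ ≡⟨ length+largestPart-fromHooks (distinctPartition-tail d) ⟩
  suc z                    ≤⟨ z<y ⟩
  y                        ∎)
  where
    open ≤-Reasoning
    μ = fromHooks (z ∷ r)

isPartition-fromHooks : ∀ {hs} → IsDistinctPartition hs → IsPartition (fromHooks hs)
isPartition-fromHooks {[]}         _ = [] , []
isPartition-fromHooks {x ∷ []}     _ = isPartition-hook (x ∸ 1) ([] , []) z≤n
isPartition-fromHooks {x ∷ y ∷ hs} d = isPartition-hook (x ∸ suc y)
  (isPartition-fromHooks (distinctPartition-tail (distinctPartition-tail d)))
  (largestPart-fromHooks-≤ (distinctPartition-tail d))

fromHooks-injective : ∀ {hs gs} → IsDistinctPartition hs → IsDistinctPartition gs →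
                      fromHooks hs ≡ fromHooks gs → hs ≡ gs
fromHooks-injective {[]}        {[]}        _ _ _  = refl
fromHooks-injective {[]}        {_ ∷ []}    _ _ ()
fromHooks-injective {[]}        {_ ∷ _ ∷ _} _ _ ()
fromHooks-injective {_ ∷ []}    {[]}        _ _ ()
fromHooks-injective {_ ∷ _ ∷ _} {[]}        _ _ ()
fromHooks-injective {x ∷ []}    {x′ ∷ []}   (_ , x>0 ∷ _) (_ , x′>0 ∷ _) eq
  with refl ← ∸-cancelʳ-≡ x>0 x′>0
                 (withColumn-injective (x ∸ 1) (x′ ∸ 1) [] [] (∷-injectiveʳ eq) .proj₂) = refl
fromHooks-injective {_ ∷ []}    {_ ∷ _ ∷ _} _ d eq =
  ⊥-elim (m<n⇒n≢0 (m<n⇒0<n∸m (length-fromHooks-< (distinctPartition-tail d)))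
                   (sym (suc-injective (proj₁ (∷-injective eq)))))
fromHooks-injective {_ ∷ _ ∷ _} {_ ∷ []}    d _ eq =
  ⊥-elim (m<n⇒n≢0 (m<n⇒0<n∸m (length-fromHooks-< (distinctPartition-tail d)))
                   (suc-injective (proj₁ (∷-injective eq))))
fromHooks-injective {x ∷ y ∷ hs} {x′ ∷ y′ ∷ gs} d@(y<x ∷ _ , _) e@(y′<x′ ∷ _ , _) eq
  with d′′ ← distinctPartition-tail (distinctPartition-tail d)
  with e′′ ← distinctPartition-tail (distinctPartition-tail e)
  with head-eq , tail-eq ← ∷-injective eq
  with inner-eq , leg-eq ← withColumn-injective (x ∸ suc y) (x′ ∸ suc y′)
         (isPartition-fromHooks d′′ .proj₂) (isPartition-fromHooks e′′ .proj₂) tail-eq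
  with refl ← fromHooks-injective d′′ e′′ inner-eq
  with refl ← ∸-cancelʳ-≡ (<⇒≤ (length-fromHooks-< (distinctPartition-tail d)))
                          (<⇒≤ (length-fromHooks-< (distinctPartition-tail e)))
                          (suc-injective head-eq)
  with refl ← ∸-cancelʳ-≡ y<x y′<x′ leg-eq = refl

fromHooks-hook : ∀ {m hs} r → 1 ≤ m → IsDistinctPartition hs → largestPart (fromHooks hs) ≤ pred m →
  Σ (List ℕ) λ gs → IsDistinctPartition gs × fromHooks gs ≡ m ∷ withColumn (fromHooks hs) r
fromHooks-hook {suc zero}    {[]}        r _ _ _  = suc r ∷ [] , ([-] , s≤s z≤n ∷ []) , refl
fromHooks-hook {suc zero}    {_ ∷ []}    _ _ _ ()
fromHooks-hook {suc zero}    {_ ∷ _ ∷ _} _ _ _ ()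
fromHooks-hook {suc (suc a)} {hs}        r _ (lk , pos) inner≤a =
  x ∷ y ∷ hs , (m≤m+n (suc y) r ∷ linked->-∷ lk inner<y , s≤s z≤n ∷ s≤s z≤n ∷ pos) ,
  cong₂ (λ u v → suc u ∷ withColumn μ v) (m+n∸n≡m (suc a) L) (m+n∸m≡n (suc y) r)
  where
    μ = fromHooks hs
    L = length μ
    y = suc a + L
    x = suc y + r
    inner<y : largestPart hs < y
    inner<y = begin-strict
      largestPart hs        ≡⟨ largestHook-fromHooks (lk , pos) ⟨
      largestHook μ         ≡⟨ largestHook≡length+largestPart∸1 μ ⟩
      L + largestPart μ ∸ 1 ≤⟨ ∸-monoˡ-≤ 1 (+-monoʳ-≤ L inner≤a) ⟩
      L + suc a ∸ 1         ≡⟨ cong (_∸ 1) (+-suc L a) ⟩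
      L + a                 <⟨ s≤s (≤-reflexive (+-comm L a)) ⟩
      y                     ∎
      where open ≤-Reasoning

fromHooks-surjective : ∀ {μ} → IsPartition μ →
                       Σ (List ℕ) λ hs → IsDistinctPartition hs × fromHooks hs ≡ μ
fromHooks-surjective {μ} = byLength (length μ) ≤-refl
  where
    byLength : ∀ {μ} k → length μ ≤ k → IsPartition μ →
               Σ (List ℕ) λ hs → IsDistinctPartition hs × fromHooks hs ≡ μ
    byLength {[]}    _       _         _               = [] , ([] , []) , refl
    byLength {m ∷ t} (suc k) (s≤s len) (lk , m>0 ∷ pos)
      with μ , r , refl , pμ , μ≤m , lenμ ← splitFirstColumn lk pos
      with hs , d , refl ← byLength k (≤-trans lenμ len) pμ
      = fromHooks-hook r m>0 d μ≤m

fromHooks-SPred⇒ΓPred : ∀ {N n hs} → SPred N n hs → ΓPred N n (fromHooks hs)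
fromHooks-SPred⇒ΓPred (d , odd≡n , ≤N) =
  isPartition-fromHooks d , trans (sum-fromHooks d) odd≡n ,
  subst (_≤ _) (sym (largestHook-fromHooks d)) ≤N

ΓPred⇒fromHooks-SPred : ∀ {N n μ} → ΓPred N n μ → Σ (List ℕ) λ hs → SPred N n hs × fromHooks hs ≡ μ
ΓPred⇒fromHooks-SPred (p , sum≡n , ≤N) with hs , d , refl ← fromHooks-surjective p =
  hs , (d , trans (sym (sum-fromHooks d)) sum≡n , subst (_≤ _) (largestHook-fromHooks d) ≤N) , refl

distinctPartitions : ℕ → List (List ℕ)
distinctPartitions zero    = [] ∷ []
distinctPartitions (suc N) = distinctPartitions N ++ map (suc N ∷_) (distinctPartitions N)

∈-distinctPartitions⁻ : ∀ N {π} → π ∈ distinctPartitions N → IsDistinctPartition π × largestPart π ≤ N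
∈-distinctPartitions⁻ zero    (here refl) = ([] , []) , z≤n
∈-distinctPartitions⁻ (suc N) π∈ with ∈-++⁻ (distinctPartitions N) π∈
... | inj₁ π∈′ = map₂ m≤n⇒m≤1+n (∈-distinctPartitions⁻ N π∈′)
... | inj₂ π∈′ with σ , σ∈ , refl ← ∈-map⁻ (suc N ∷_) π∈′
                with (lk , pos) , ≤N ← ∈-distinctPartitions⁻ N σ∈ =
  (linked->-∷ lk (s≤s ≤N) , s≤s z≤n ∷ pos) , ≤-refl

∈-distinctPartitions⁺ : ∀ N {π} → IsDistinctPartition π → largestPart π ≤ N → π ∈ distinctPartitions N
∈-distinctPartitions⁺ zero    {[]}        _               _  = here refl
∈-distinctPartitions⁺ zero    {_ ∷ _}     (_ , s≤s _ ∷ _) ()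
∈-distinctPartitions⁺ (suc N) {[]}        d               _  = ∈-++⁺ˡ (∈-distinctPartitions⁺ N d z≤n)
∈-distinctPartitions⁺ (suc N) {x ∷ σ}     d               x≤ with m≤n⇒m<n∨m≡n x≤
... | inj₁ x<sN = ∈-++⁺ˡ (∈-distinctPartitions⁺ N d (≤-pred x<sN))
... | inj₂ refl = ∈-++⁺ʳ (distinctPartitions N)
  (∈-map⁺ (suc N ∷_) (∈-distinctPartitions⁺ N (distinctPartition-tail d) (≤-pred (largestPart-tail-< d))))

distinctPartitions-unique : ∀ N → Unique (distinctPartitions N)
distinctPartitions-unique zero    = [] ∷ []
distinctPartitions-unique (suc N) =
  Unique.++⁺ (distinctPartitions-unique N) (Unique.map⁺ ∷-injectiveʳ (distinctPartitions-unique N)) disjoint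
  where
    disjoint : ∀ {π} → ¬ (π ∈ distinctPartitions N × π ∈ map (suc N ∷_) (distinctPartitions N))
    disjoint (π∈ , π∈′) with _ , _ , refl ← ∈-map⁻ (suc N ∷_) π∈′ =
      n≮n N (∈-distinctPartitions⁻ N π∈ .proj₂)

hasCount-SPred : ∀ N n →
  HasCount (SPred N n) (length (filter (λ π → oddSum π ≟ n) (distinctPartitions N)))
hasCount-SPred N n = hasCount-⇔ (λ π → mk⇔ (λ ((d , ≤N) , odd≡n) → d , odd≡n , ≤N)
                                           (λ (d , odd≡n , ≤N) → (d , ≤N) , odd≡n))
  (hasCount-filter (distinctPartitions-unique N)
     (λ π → mk⇔ (∈-distinctPartitions⁻ N) (λ (d , ≤N) → ∈-distinctPartitions⁺ N d ≤N))
     (λ π → oddSum π ≟ n))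

theorem3p3 : (N n : ℕ) → Σ ℕ λ k → HasCount (SPred N n) k × HasCount (ΓPred N n) k
theorem3p3 N n = _ , hasCount-SPred N n ,
  hasCount-image fromHooks fromHooks-SPred⇒ΓPred
    (λ s t → fromHooks-injective (proj₁ s) (proj₁ t)) ΓPred⇒fromHooks-SPred (hasCount-SPred N n)
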